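{- Let $m$ be a fixed positive integer and $t$ a positive integer variable. Then $$R I(TG_{m,t})\asymp\sum_{k=0}^\infty 2^{(k+\lfloor k/2\rfloor)t}x^k\pmod{x^{2m+1}}.$$
   Context: For a simple graph $G$, $I(G)=\sum_k s_kx^k$ is its independence polynomial ($s_k$ = number of independent sets of size $k$). For a polynomial $p$ of degree $n$, the reflected polynomial is $Rp(x)=x^np(1/x)$. $P_n$ is the path on $n$ vertices. $T_{3,t}$ is the tree with a root $v$ having $3$ children, each of which has $t$ pendant copies of $P_2$ attached. $TG_{m,t}$ is obtained by taking $m$ disjoint copies of $T_{3,t}$, joining the root $v$ of each copy to a new vertex $v_0$, and adding one further vertex adjacent only to $v_0$. For functions $a,b$ of $t$, $a\in\Theta(b)$ means there are constants $c_1,c_2>0$ and $t_0$ with $c_1b(t)\le a(t)\le c_2b(t)$ for all $t\ge t_0$. For generating functions $\sum_k a_k(t)x^k$, $\sum_k b_k(t)x^k$ with eventually nonnegative coefficients, $\sum_k a_k(t)x^k\asymp\sum_k b_k(t)x^k\pmod{x^M}$ means $a_k(t)\in\Theta(b_k(t))$ for all $0\le k\le M-1$. -}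

module Defs where

open import Data.Nat using (ℕ; zero; suc; _+_; _*_; _∸_; _^_; _/_; _≤_; _≤ᵇ_; _≡ᵇ_; _⊔_)
open import Data.Bool using (Bool; true; false; _∧_; _∨_; not; if_then_else_)
open import Data.List using (List; []; _∷_; _++_; map; length; filterᵇ; replicate; allFin; upTo; foldr)
open import Data.Bool.ListAction using (all; any)
open import Data.Product using (∃)
open import Data.Product using (_×_; _,_)
open import Data.Fin using (Fin; toℕ)
open import Data.Vec using (Vec; []; _∷_; lookup)
open import Data.Fin.Subset using (Subset; inside; outside; ∣_∣)

-- Finite simple graphs on vertex set Fin n, with a Boolean adjacency
-- relation (symmetric, irreflexive for all graphs built below).

record Graph : Set where
  field
    size : ℕ
    adj  : Fin size → Fin size → Bool
open Graph public

allSubsets : (n : ℕ) → List (Subset n)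
allSubsets zero    = [] ∷ []
allSubsets (suc n) = map (outside ∷_) (allSubsets n) ++ map (inside ∷_) (allSubsets n)

member : {n : ℕ} → Subset n → Fin n → Bool
member s i with lookup s i
... | inside  = true
... | outside = false

-- s is independent: no two (not necessarily distinct) members adjacent
isIndependent : (G : Graph) → Subset (size G) → Bool
isIndependent G s =
  all (λ i → all (λ j → not (member s i ∧ member s j ∧ adj G i j)) (allFin (size G)))
      (allFin (size G))

indepCount : Graph → ℕ → ℕ
indepCount G k =
  length (filterᵇ (λ s → (∣ s ∣ ≡ᵇ k) ∧ isIndependent G s) (allSubsets (size G)))

indepDegree : Graph → ℕ
indepDegree G =
  foldr (λ k d → if indepCount G k ≡ᵇ 0 then d else (k ⊔ d)) 0 (upTo (suc (size G)))

-- coefficient of x^k in the reflected polynomial R I(G) = x^n I(G)(1/x)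
reflIndepCoeff : Graph → ℕ → ℕ
reflIndepCoeff G k =
  if k ≤ᵇ indepDegree G then indepCount G (indepDegree G ∸ k) else 0

-- Rooted trees, realised as graphs with preorder vertex labelling.

data Tree : Set where
  node : List Tree → Tree

mutual
  tsize : Tree → ℕ
  tsize (node ts) = suc (tsizes ts)

  tsizes : List Tree → ℕ
  tsizes []       = 0
  tsizes (t ∷ ts) = tsize t + tsizes ts

-- edges of a tree whose root carries label o (children subtrees follow
-- consecutively in preorder)
mutual
  tedges : ℕ → Tree → List (ℕ × ℕ)
  tedges o (node ts) = childEdges o (suc o) ts

  -- parent label p, next free label o'
  childEdges : ℕ → ℕ → List Tree → List (ℕ × ℕ)
  childEdges p o' []       = []
  childEdges p o' (t ∷ ts) = (p , o') ∷ (tedges o' t ++ childEdges p (o' + tsize t) ts)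

isEdge : List (ℕ × ℕ) → ℕ → ℕ → Bool
isEdge es a b = any (λ { (u , v) → ((u ≡ᵇ a) ∧ (v ≡ᵇ b)) ∨ ((u ≡ᵇ b) ∧ (v ≡ᵇ a)) }) es

treeGraph : Tree → Graph
treeGraph t = record
  { size = tsize t
  ; adj  = λ i j → isEdge (tedges 0 t) (toℕ i) (toℕ j) }

leaf : Tree
leaf = node []

pendantP2 : Tree
pendantP2 = node (leaf ∷ [])

-- a child of the root of T_{3,t}: a vertex with t pendant copies of P_2
childT : ℕ → Tree
childT t = node (replicate t pendantP2)

T3 : ℕ → Tree
T3 t = node (replicate 3 (childT t))

-- TG_{m,t}: new vertex v0 joined to the roots of m copies of T_{3,t}
-- and to one further (leaf) vertex
TGtree : ℕ → ℕ → Tree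
TGtree m t = node (leaf ∷ replicate m (T3 t))

TG : ℕ → ℕ → Graph
TG m t = treeGraph (TGtree m t)

-- a(t) ∈ Θ(b(t)) for ℕ-valued functions (constants as naturals; for
-- ℕ-valued functions with b(t) ≥ 1 this is equivalent to real constants)

Theta : (ℕ → ℕ) → (ℕ → ℕ) → Set
Theta a b = ∃ λ c₁ → ∃ λ c₂ → ∃ λ t₀ → (t : ℕ) → t₀ ≤ t → (b t ≤ c₁ * a t) × (a t ≤ c₂ * b t)

-- Counting the independent sets of a tree by the number of vertices they leave out turns I(x)
-- into x^n I(1/x), and for rooted trees these polynomials obey G(v) = x ∏ G(c) + ∏ G⁰(c) and
-- G⁰(v) = x ∏ G(c), where c ranges over the children of v and G⁰ counts the sets avoiding the
-- root.  On TG_{m,t} the recursion yields x^σ D with D = (1 + x) Q^m + A^m, where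
-- A = (x (2 + x)^t + (1 + x)^t)³ and Q = A + x² (2 + x)^{3t}; so R I(TG_{m,t}) agrees with D.
-- The k-th coefficient of (a + x)^t is at most a^t t^k, so every factor has k-th coefficient
-- O(2^{E(k) t}) for E(k) = k + ⌊k/2⌋, and since E is superadditive this survives products.
-- Conversely, for k ≤ 2m the k-th coefficient of Q^m is at least Q₂^⌊k/2⌋ Q₁^(k mod 2) Q₀^…,
-- and Q₀ ≥ 1, Q₁ ≥ 2^t, Q₂ ≥ 2^{3t} = 2^{E(2) t}.

{-# OPTIONS --safe #-}
module Submission where

open import Defs
import Algebra.Properties.CommutativeSemigroup as CommutativeSemigroupProperties
open import Data.Bool using (Bool; true; false; T; _∧_; not; if_then_else_)
open import Data.Bool.ListAction using (all)
open import Data.Bool.Properties using (∧-assoc; ∧-identityʳ; ∧-zeroʳ; T-∧; T-∨; T-≡; T-not-≡)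
open import Data.Empty using (⊥-elim)
open import Data.Fin using (Fin; toℕ; fromℕ<)
open import Data.Fin.Properties using (toℕ-fromℕ<)
open import Data.Fin.Subset using (Subset; Side; inside; outside; ∣_∣; ∁)
open import Data.Fin.Subset.Properties using (∣p∣≤n; ∣∁p∣≡n∸∣p∣)
open import Data.List using (List; []; _∷_; length; filterᵇ; map; replicate; foldr; upTo; allFin)
  renaming (_++_ to _++ₗ_)
open import Data.List.Membership.Propositional using (_∈_)
open import Data.List.Membership.Propositional.Properties using (∈-allFin; ∈-upTo⁺)
open import Data.List.Properties using (length-++; ++-assoc; ++-identityʳ)
open import Data.List.Relation.Unary.All as All using ()
open import Data.List.Relation.Unary.All.Properties using (all⁺; all⁻; tabulate⁺)
open import Data.List.Relation.Unary.Any using (here; there)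
open import Data.Nat
  using (ℕ; zero; suc; _+_; _*_; _∸_; _^_; _/_; _≤_; _<_; z≤n; s≤s; _≡ᵇ_; _⊔_; _≤?_; NonZero)
open import Data.Nat.DivMod using (m/n≡1+[m∸n]/n; /-monoˡ-≤)
open import Data.Nat.Properties
open import Data.Nat.Solver using (module +-*-Solver)
open import Data.Product using (Σ-syntax; _×_; _,_)
open import Data.Sum using (_⊎_; inj₁; inj₂)
open import Data.Vec using (Vec; []; _∷_; _++_; lookup; toList; take; drop)
open import Data.Vec.Properties using (toList-++; length-toList; take++drop≡id)
open import Function.Bundles using (Equivalence)
open import Relation.Nullary using (¬_; yes; no)
open import Relation.Binary.PropositionalEquality
import Relation.Binary.Reasoning.Setoid

open +-*-Solver using (solve; _:+_; _:*_; _:=_; con)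

open CommutativeSemigroupProperties +-commutativeSemigroup using () renaming (interchange to +-interchange)
open CommutativeSemigroupProperties *-commutativeSemigroup using () renaming (interchange to *-interchange)

module ≗-Reasoning = Relation.Binary.Reasoning.Setoid (ℕ →-setoid ℕ)

-- Polynomials with natural coefficients

Poly : Set
Poly = ℕ → ℕ

0ₚ : Poly
0ₚ _ = 0

1ₚ : Poly
1ₚ zero    = 1
1ₚ (suc _) = 0

X+_ : ℕ → Poly
(X+ a) zero          = a
(X+ a) (suc zero)    = 1
(X+ a) (suc (suc _)) = 0

shift : Poly → Poly
shift p zero    = 0
shift p (suc k) = p k

shift^ : ℕ → Poly → Poly
shift^ zero    p = p
shift^ (suc a) p = shift (shift^ a p)

X^ : ℕ → Poly
X^ a = shift^ a 1ₚ

tail : Poly → Poly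
tail p k = p (suc k)

infixl 6 _⊕_
infixl 7 _⊛_
infixl 8 _^ₚ_

_⊕_ : Poly → Poly → Poly
(p ⊕ q) k = p k + q k

_⊛_ : Poly → Poly → Poly
(p ⊛ q) zero    = p 0 * q 0
(p ⊛ q) (suc k) = p 0 * q (suc k) + (tail p ⊛ q) k

_^ₚ_ : Poly → ℕ → Poly
p ^ₚ zero  = 1ₚ
p ^ₚ suc n = p ⊛ p ^ₚ n

⊕-cong : ∀ {p p′ q q′} → p ≗ p′ → q ≗ q′ → p ⊕ q ≗ p′ ⊕ q′
⊕-cong e f k = cong₂ _+_ (e k) (f k)

⊛-cong : ∀ {p p′ q q′} → p ≗ p′ → q ≗ q′ → p ⊛ q ≗ p′ ⊛ q′
⊛-cong e f zero    = cong₂ _*_ (e 0) (f 0)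
⊛-cong e f (suc k) = cong₂ _+_ (cong₂ _*_ (e 0) (f (suc k))) (⊛-cong (λ i → e (suc i)) f k)

shift-cong : ∀ {p p′} → p ≗ p′ → shift p ≗ shift p′
shift-cong e zero    = refl
shift-cong e (suc k) = e k

shift^-cong : ∀ a {p p′} → p ≗ p′ → shift^ a p ≗ shift^ a p′
shift^-cong zero    e = e
shift^-cong (suc a) e = shift-cong (shift^-cong a e)

^ₚ-cong : ∀ {p p′} n → p ≗ p′ → p ^ₚ n ≗ p′ ^ₚ n
^ₚ-cong zero    e k = refl
^ₚ-cong (suc n) e   = ⊛-cong e (^ₚ-cong n e)

⊛-zeroˡ : ∀ q → 0ₚ ⊛ q ≗ 0ₚ
⊛-zeroˡ q zero    = refl
⊛-zeroˡ q (suc k) = ⊛-zeroˡ q k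

⊛-zeroʳ : ∀ p → p ⊛ 0ₚ ≗ 0ₚ
⊛-zeroʳ p zero    = *-zeroʳ (p 0)
⊛-zeroʳ p (suc k) = cong₂ _+_ (*-zeroʳ (p 0)) (⊛-zeroʳ (tail p) k)

⊛-identityˡ : ∀ q → 1ₚ ⊛ q ≗ q
⊛-identityˡ q zero    = +-identityʳ (q 0)
⊛-identityˡ q (suc k) =
  trans (cong₂ _+_ (+-identityʳ (q (suc k))) (⊛-zeroˡ q k)) (+-identityʳ _)

⊛-identityʳ : ∀ p → p ⊛ 1ₚ ≗ p
⊛-identityʳ p zero    = *-identityʳ (p 0)
⊛-identityʳ p (suc k) = cong₂ _+_ (*-zeroʳ (p 0)) (⊛-identityʳ (tail p) k)

⊛-distribˡ-⊕ : ∀ p q r → p ⊛ (q ⊕ r) ≗ p ⊛ q ⊕ p ⊛ r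
⊛-distribˡ-⊕ p q r zero    = *-distribˡ-+ (p 0) (q 0) (r 0)
⊛-distribˡ-⊕ p q r (suc k) =
  trans (cong₂ _+_ (*-distribˡ-+ (p 0) (q (suc k)) (r (suc k))) (⊛-distribˡ-⊕ (tail p) q r k))
        (+-interchange (p 0 * q (suc k)) (p 0 * r (suc k)) ((tail p ⊛ q) k) ((tail p ⊛ r) k))

⊛-distribʳ-⊕ : ∀ p q r → (q ⊕ r) ⊛ p ≗ q ⊛ p ⊕ r ⊛ p
⊛-distribʳ-⊕ p q r zero    = *-distribʳ-+ (p 0) (q 0) (r 0)
⊛-distribʳ-⊕ p q r (suc k) =
  trans (cong₂ _+_ (*-distribʳ-+ (p (suc k)) (q 0) (r 0)) (⊛-distribʳ-⊕ p (tail q) (tail r) k))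
        (+-interchange (q 0 * p (suc k)) (r 0 * p (suc k)) ((tail q ⊛ p) k) ((tail r ⊛ p) k))

shift-⊛ : ∀ p q → shift p ⊛ q ≗ shift (p ⊛ q)
shift-⊛ p q zero    = refl
shift-⊛ p q (suc k) = refl

⊛-shift : ∀ p q → p ⊛ shift q ≗ shift (p ⊛ q)
⊛-shift p q zero          = *-zeroʳ (p 0)
⊛-shift p q (suc zero)    = trans (cong (p 0 * q 0 +_) (⊛-shift (tail p) q zero)) (+-identityʳ _)
⊛-shift p q (suc (suc k)) = cong (p 0 * q (suc k) +_) (⊛-shift (tail p) q (suc k))

shift-⊕ : ∀ p q → shift p ⊕ shift q ≗ shift (p ⊕ q)
shift-⊕ p q zero    = refl
shift-⊕ p q (suc k) = refl

shift^-⊕ : ∀ a p q → shift^ a p ⊕ shift^ a q ≗ shift^ a (p ⊕ q)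
shift^-⊕ zero    p q k = refl
shift^-⊕ (suc a) p q k = trans (shift-⊕ (shift^ a p) (shift^ a q) k) (shift-cong (shift^-⊕ a p q) k)

shift^-+ : ∀ a b p → shift^ a (shift^ b p) ≡ shift^ (a + b) p
shift^-+ zero    b p = refl
shift^-+ (suc a) b p = cong shift (shift^-+ a b p)

shift^-⊛ : ∀ a p q → shift^ a p ⊛ q ≗ shift^ a (p ⊛ q)
shift^-⊛ zero    p q k = refl
shift^-⊛ (suc a) p q k = trans (shift-⊛ (shift^ a p) q k) (shift-cong (shift^-⊛ a p q) k)

⊛-shift^ : ∀ a p q → p ⊛ shift^ a q ≗ shift^ a (p ⊛ q)
⊛-shift^ zero    p q k = refl
⊛-shift^ (suc a) p q k = trans (⊛-shift p (shift^ a q) k) (shift-cong (⊛-shift^ a p q) k)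

shift^-⊛-shift^ : ∀ a b p q → shift^ a p ⊛ shift^ b q ≗ shift^ (a + b) (p ⊛ q)
shift^-⊛-shift^ a b p q k =
  trans (shift^-⊛ a p (shift^ b q) k)
        (trans (shift^-cong a (⊛-shift^ b p q) k) (cong (λ f → f k) (shift^-+ a b (p ⊛ q))))

shift^-^ₚ : ∀ a p n → shift^ a p ^ₚ n ≗ shift^ (n * a) (p ^ₚ n)
shift^-^ₚ a p zero    k = refl
shift^-^ₚ a p (suc n) k =
  trans (⊛-cong (λ _ → refl) (shift^-^ₚ a p n) k) (shift^-⊛-shift^ a (n * a) p (p ^ₚ n) k)

X^-+ : ∀ a b → X^ (a + b) ≗ X^ a ⊛ X^ b
X^-+ a b k = sym (trans (shift^-⊛-shift^ a b 1ₚ 1ₚ k) (shift^-cong (a + b) (⊛-identityˡ 1ₚ) k))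

-- Exponential bounds on coefficients

infix 4 _≤ₚ_

_≤ₚ_ : Poly → Poly → Set
p ≤ₚ q = ∀ k → p k ≤ q k

_·_ : Poly → (ℕ → ℕ) → Poly
(c · u) k = c k * u k

⊛-mono : ∀ {p p′ q q′} → p ≤ₚ p′ → q ≤ₚ q′ → p ⊛ q ≤ₚ p′ ⊛ q′
⊛-mono f g zero    = *-mono-≤ (f 0) (g 0)
⊛-mono f g (suc k) = +-mono-≤ (*-mono-≤ (f 0) (g (suc k))) (⊛-mono (λ i → f (suc i)) g k)

⊛-weighted-≤ : ∀ {u v w : ℕ → ℕ} → (∀ i j → u i * v j ≤ w (i + j)) →
               ∀ c d → (c · u) ⊛ (d · v) ≤ₚ (c ⊛ d) · w
⊛-weighted-≤ {u} {v} {w} uv≤w c d zero = begin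
  (c 0 * u 0) * (d 0 * v 0) ≡⟨ *-interchange (c 0) (u 0) (d 0) (v 0) ⟩
  (c 0 * d 0) * (u 0 * v 0) ≤⟨ *-monoʳ-≤ (c 0 * d 0) (uv≤w 0 0) ⟩
  (c 0 * d 0) * w 0         ∎
  where open ≤-Reasoning
⊛-weighted-≤ {u} {v} {w} uv≤w c d (suc k) = begin
  (c 0 * u 0) * (d (suc k) * v (suc k)) + ((tail c · tail u) ⊛ (d · v)) k
    ≡⟨ cong (_+ ((tail c · tail u) ⊛ (d · v)) k) (*-interchange (c 0) (u 0) (d (suc k)) (v (suc k))) ⟩
  (c 0 * d (suc k)) * (u 0 * v (suc k)) + ((tail c · tail u) ⊛ (d · v)) k
    ≤⟨ +-mono-≤ (*-monoʳ-≤ (c 0 * d (suc k)) (uv≤w 0 (suc k)))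
                (⊛-weighted-≤ {tail u} {v} {tail w} (λ i j → uv≤w (suc i) j) (tail c) d k) ⟩
  (c 0 * d (suc k)) * w (suc k) + (tail c ⊛ d) k * w (suc k)
    ≡⟨ *-distribʳ-+ (w (suc k)) (c 0 * d (suc k)) ((tail c ⊛ d) k) ⟨
  (c ⊛ d) (suc k) * w (suc k) ∎
  where open ≤-Reasoning

growth : (ℕ → ℕ) → ℕ → ℕ → ℕ
growth e t k = 2 ^ (e k * t)

infixr 4 _,_

record Dominated (e : ℕ → ℕ) (F : ℕ → Poly) : Set where
  constructor _,_
  field
    constant : Poly
    bound    : ∀ t → F t ≤ₚ constant · growth e t

2^[*t]-mono : ∀ {a b} t → a ≤ b → 2 ^ (a * t) ≤ 2 ^ (b * t)
2^[*t]-mono t a≤b = ^-monoʳ-≤ 2 (*-monoˡ-≤ t a≤b)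

2^[*t]-+ : ∀ a b t → 2 ^ (a * t) * 2 ^ (b * t) ≡ 2 ^ ((a + b) * t)
2^[*t]-+ a b t = trans (sym (^-distribˡ-+-* 2 (a * t) (b * t))) (cong (2 ^_) (sym (*-distribʳ-+ t a b)))

dominated-const : ∀ e p → Dominated e (λ _ → p)
dominated-const e p = p , λ t k → m≤m*n (p k) (2 ^ (e k * t)) {{m^n≢0 2 (e k * t)}}

dominated-⊕ : ∀ {e F G} → Dominated e F → Dominated e G → Dominated e (λ t → F t ⊕ G t)
dominated-⊕ {e} (c , F≤) (d , G≤) = c ⊕ d , λ t k →
  ≤-trans (+-mono-≤ (F≤ t k) (G≤ t k)) (≤-reflexive (sym (*-distribʳ-+ (growth e t k) (c k) (d k))))

dominated-shift : ∀ {e e′ F} → (∀ k → e k ≤ e′ (suc k)) →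
                  Dominated e F → Dominated e′ (λ t → shift (F t))
dominated-shift e≤e′ (c , F≤) = shift c , λ where
  t zero    → z≤n
  t (suc k) → ≤-trans (F≤ t k) (*-monoʳ-≤ (c k) (2^[*t]-mono t (e≤e′ k)))

dominated-mono : ∀ {e e′ F} → (∀ k → e k ≤ e′ k) → Dominated e F → Dominated e′ F
dominated-mono e≤e′ (c , F≤) = c , λ t k → ≤-trans (F≤ t k) (*-monoʳ-≤ (c k) (2^[*t]-mono t (e≤e′ k)))

dominated-⊛ : ∀ {e₁ e₂ e₃ F G} → (∀ i j → e₁ i + e₂ j ≤ e₃ (i + j)) →
              Dominated e₁ F → Dominated e₂ G → Dominated e₃ (λ t → F t ⊛ G t)
dominated-⊛ {e₁} {e₂} {e₃} sup (c , F≤) (d , G≤) = c ⊛ d , λ t k →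
  ≤-trans (⊛-mono (F≤ t) (G≤ t) k)
          (⊛-weighted-≤ {growth e₁ t} {growth e₂ t} {growth e₃ t} (growth-sup t) c d k)
  where
  growth-sup : ∀ t i j → growth e₁ t i * growth e₂ t j ≤ growth e₃ t (i + j)
  growth-sup t i j = ≤-trans (≤-reflexive (2^[*t]-+ (e₁ i) (e₂ j) t)) (2^[*t]-mono t (sup i j))

dominated-^ₚ : ∀ {e F} (f : ℕ → ℕ → ℕ) → (∀ n i j → e i + f n j ≤ f (suc n) (i + j)) →
               Dominated e F → ∀ n → Dominated (f n) (λ t → F t ^ₚ n)
dominated-^ₚ f sup dF zero    = dominated-const (f 0) 1ₚ
dominated-^ₚ f sup dF (suc n) = dominated-⊛ (sup n) dF (dominated-^ₚ f sup dF n)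

n≤2^n : ∀ n → n ≤ 2 ^ n
n≤2^n zero    = z≤n
n≤2^n (suc n) = begin
  1 + n         ≤⟨ +-mono-≤ (m^n>0 2 n) (n≤2^n n) ⟩
  2 ^ n + 2 ^ n ≡⟨ cong (2 ^ n +_) (+-identityʳ (2 ^ n)) ⟨
  2 ^ suc n     ∎
  where open ≤-Reasoning

X+-^ₚ-coeff : ∀ a .{{_ : NonZero a}} n i → (X+ a ^ₚ n) i ≤ a ^ n * n ^ i
X+-^ₚ-coeff a zero    zero    = s≤s z≤n
X+-^ₚ-coeff a zero    (suc i) = z≤n
X+-^ₚ-coeff a (suc n) zero    = begin
  a * (X+ a ^ₚ n) 0 ≤⟨ *-monoʳ-≤ a (X+-^ₚ-coeff a n 0) ⟩
  a * (a ^ n * 1)   ≡⟨ *-assoc a (a ^ n) 1 ⟨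
  a * a ^ n * 1     ∎
  where open ≤-Reasoning
X+-^ₚ-coeff a (suc n) (suc i) = begin
  a * (X+ a ^ₚ n) (suc i) + (tail (X+ a) ⊛ X+ a ^ₚ n) i
    ≡⟨ cong (a * (X+ a ^ₚ n) (suc i) +_)
            (trans (⊛-cong tail-X+ (λ _ → refl) i) (⊛-identityˡ (X+ a ^ₚ n) i)) ⟩
  a * (X+ a ^ₚ n) (suc i) + (X+ a ^ₚ n) i
    ≤⟨ +-mono-≤ (*-monoʳ-≤ a (X+-^ₚ-coeff a n (suc i))) (X+-^ₚ-coeff a n i) ⟩
  a * (a ^ n * (n * n ^ i)) + a ^ n * n ^ i
    ≤⟨ +-monoʳ-≤ (a * (a ^ n * (n * n ^ i))) (m≤n*m (a ^ n * n ^ i) a) ⟩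
  a * (a ^ n * (n * n ^ i)) + a * (a ^ n * n ^ i)
    ≡⟨ collect a (a ^ n) n (n ^ i) ⟩
  a * a ^ n * (suc n * n ^ i)
    ≤⟨ *-monoʳ-≤ (a * a ^ n) (*-monoʳ-≤ (suc n) (^-monoˡ-≤ i (n≤1+n n))) ⟩
  a * a ^ n * (suc n * suc n ^ i) ∎
  where
  open ≤-Reasoning
  tail-X+ : tail (X+ a) ≗ 1ₚ
  tail-X+ zero    = refl
  tail-X+ (suc _) = refl
  collect : ∀ a x n y → a * (x * (n * y)) + a * (x * y) ≡ a * x * ((1 + n) * y)
  collect = solve 4 (λ a x n y → a :* (x :* (n :* y)) :+ a :* (x :* y) := a :* x :* ((con 1 :+ n) :* y)) refl

dominated-X+-^ₚ : ∀ a b .{{_ : NonZero a}} → a ≤ 2 ^ b → Dominated (b +_) (λ t → X+ a ^ₚ t)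
dominated-X+-^ₚ a b a≤2^b = (λ _ → 1) , λ t k → begin
  (X+ a ^ₚ t) k             ≤⟨ X+-^ₚ-coeff a t k ⟩
  a ^ t * t ^ k             ≤⟨ *-mono-≤ (^-monoˡ-≤ t a≤2^b) (^-monoˡ-≤ k (n≤2^n t)) ⟩
  (2 ^ b) ^ t * (2 ^ t) ^ k ≡⟨ cong₂ _*_ (^-*-assoc 2 b t) (trans (^-*-assoc 2 t k) (cong (2 ^_) (*-comm t k))) ⟩
  2 ^ (b * t) * 2 ^ (k * t) ≡⟨ 2^[*t]-+ b k t ⟩
  2 ^ ((b + k) * t)         ≡⟨ *-identityˡ _ ⟨
  1 * 2 ^ ((b + k) * t)     ∎
  where open ≤-Reasoning

E : ℕ → ℕ
E k = k + k / 2

[2+k]/2 : ∀ k → (2 + k) / 2 ≡ suc (k / 2)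
[2+k]/2 k = m/n≡1+[m∸n]/n {2 + k} {2} (s≤s (s≤s z≤n))

E-2+ : ∀ k → E (2 + k) ≡ 3 + E k
E-2+ k = trans (cong (2 + k +_) ([2+k]/2 k)) (cong (2 +_) (+-suc k (k / 2)))

/2-superadditive : ∀ i j → i / 2 + j / 2 ≤ (i + j) / 2
/2-superadditive zero          j = ≤-refl
/2-superadditive (suc zero)    j = /-monoˡ-≤ 2 (n≤1+n j)
/2-superadditive (suc (suc i)) j rewrite [2+k]/2 i | [2+k]/2 (i + j) = s≤s (/2-superadditive i j)

E-superadditive : ∀ i j → E i + E j ≤ E (i + j)
E-superadditive i j = begin
  (i + i / 2) + (j + j / 2) ≡⟨ +-interchange i (i / 2) j (j / 2) ⟩
  (i + j) + (i / 2 + j / 2) ≤⟨ +-monoʳ-≤ (i + j) (/2-superadditive i j) ⟩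
  (i + j) + (i + j) / 2     ∎
  where open ≤-Reasoning

k≤E : ∀ k → k ≤ E k
k≤E k = m≤m+n k (k / 2)

-- In the notation above, childPoly t ^ₚ 3 = A, T3Poly t = Q and TGPoly m t = D.
childPoly : ℕ → Poly
childPoly t = shift (X+ 2 ^ₚ t) ⊕ X+ 1 ^ₚ t

T3Poly : ℕ → Poly
T3Poly t = childPoly t ^ₚ 3 ⊕ shift (shift (X+ 2 ^ₚ t ^ₚ 3))

TGPoly : ℕ → ℕ → Poly
TGPoly m t = X+ 1 ⊛ T3Poly t ^ₚ m ⊕ childPoly t ^ₚ 3 ^ₚ m

dominated-E-^ₚ : ∀ {F} → Dominated E F → ∀ n → Dominated E (λ t → F t ^ₚ n)
dominated-E-^ₚ = dominated-^ₚ (λ _ → E) (λ _ → E-superadditive)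

childPoly-dominated : Dominated E childPoly
childPoly-dominated = dominated-⊕
  (dominated-shift (λ k → k≤E (suc k)) (dominated-X+-^ₚ 2 1 ≤-refl))
  (dominated-mono k≤E (dominated-X+-^ₚ 1 0 ≤-refl))

T3Poly-dominated : Dominated E T3Poly
T3Poly-dominated = dominated-⊕ (dominated-E-^ₚ childPoly-dominated 3) x²[2+x]³ᵗ-dominated
  where
  shuffle : ∀ n i j → (1 + i) + (n + j) ≡ suc n + (i + j)
  shuffle = solve 3 (λ n i j → (con 1 :+ i) :+ (n :+ j) := (con 1 :+ n) :+ (i :+ j)) refl
  [2+x]³ᵗ-dominated : Dominated (3 +_) (λ t → X+ 2 ^ₚ t ^ₚ 3)
  [2+x]³ᵗ-dominated = dominated-^ₚ _+_ (λ n i j → ≤-reflexive (shuffle n i j)) (dominated-X+-^ₚ 2 1 ≤-refl) 3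
  x²[2+x]³ᵗ-dominated : Dominated E (λ t → shift (shift (X+ 2 ^ₚ t ^ₚ 3)))
  x²[2+x]³ᵗ-dominated = dominated-shift (λ _ → ≤-refl)
    (dominated-shift (λ k → ≤-trans (+-monoʳ-≤ 3 (k≤E k)) (≤-reflexive (sym (E-2+ k)))) [2+x]³ᵗ-dominated)

TGPoly-dominated : ∀ m → Dominated E (TGPoly m)
TGPoly-dominated m = dominated-⊕
  (dominated-⊛ E-superadditive (dominated-const E (X+ 1)) (dominated-E-^ₚ T3Poly-dominated m))
  (dominated-E-^ₚ (dominated-E-^ₚ childPoly-dominated 3) m)

⊛-coeff-≥ : ∀ p q i j → p i * q j ≤ (p ⊛ q) (i + j)
⊛-coeff-≥ p q zero    zero    = ≤-refl
⊛-coeff-≥ p q zero    (suc j) = m≤m+n _ _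
⊛-coeff-≥ p q (suc i) j       = ≤-trans (⊛-coeff-≥ (tail p) q i j) (m≤n+m _ _)

^ₚ-coeff-0 : ∀ p n → (p ^ₚ n) 0 ≡ p 0 ^ n
^ₚ-coeff-0 p zero    = refl
^ₚ-coeff-0 p (suc n) = cong (p 0 *_) (^ₚ-coeff-0 p n)

⊛-lower-bound : ∀ (e : ℕ → ℕ) t p q i j → 2 ^ (e i * t) ≤ p i → 2 ^ (e j * t) ≤ q j →
                e i + e j ≡ e (i + j) →
          2 ^ (e (i + j) * t) ≤ (p ⊛ q) (i + j)
⊛-lower-bound e t p q i j p≥ q≥ e-additive = begin
  2 ^ (e (i + j) * t)           ≡⟨ cong (λ a → 2 ^ (a * t)) e-additive ⟨
  2 ^ ((e i + e j) * t)         ≡⟨ 2^[*t]-+ (e i) (e j) t ⟨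
  2 ^ (e i * t) * 2 ^ (e j * t) ≤⟨ *-mono-≤ p≥ q≥ ⟩
  p i * q j                     ≤⟨ ⊛-coeff-≥ p q i j ⟩
  (p ⊛ q) (i + j)               ∎
  where open ≤-Reasoning

^ₚ-lower-bound : ∀ t q → (∀ i → i ≤ 2 → 2 ^ (E i * t) ≤ q i) →
           ∀ m k → k ≤ 2 * m → 2 ^ (E k * t) ≤ (q ^ₚ m) k
^ₚ-lower-bound t q q≥ zero    zero          _   = ≤-refl
^ₚ-lower-bound t q q≥ (suc m) zero          _   =
  ⊛-lower-bound E t q (q ^ₚ m) 0 0 (q≥ 0 z≤n) (^ₚ-lower-bound t q q≥ m 0 z≤n) refl
^ₚ-lower-bound t q q≥ (suc m) (suc zero)    _   =
  ⊛-lower-bound E t q (q ^ₚ m) 1 0 (q≥ 1 (s≤s z≤n)) (^ₚ-lower-bound t q q≥ m 0 z≤n) refl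
^ₚ-lower-bound t q q≥ (suc m) (suc (suc k)) k≤ =
  ⊛-lower-bound E t q (q ^ₚ m) 2 k (q≥ 2 ≤-refl) (^ₚ-lower-bound t q q≥ m k k≤2m) (sym (E-2+ k))
  where
  k≤2m : k ≤ 2 * m
  k≤2m = +-cancelˡ-≤ 2 k (2 * m) (≤-trans k≤ (≤-reflexive (*-suc 2 m)))

childPoly-^ₚ-coeff-0 : ∀ t n → (childPoly t ^ₚ n) 0 ≡ 1
childPoly-^ₚ-coeff-0 t n = begin
  (childPoly t ^ₚ n) 0 ≡⟨ ^ₚ-coeff-0 (childPoly t) n ⟩
  childPoly t 0 ^ n    ≡⟨ cong (_^ n) (trans (^ₚ-coeff-0 (X+ 1) t) (^-zeroˡ t)) ⟩
  1 ^ n                ≡⟨ ^-zeroˡ n ⟩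
  1                    ∎
  where open ≡-Reasoning

T3Poly-lower-bound : ∀ t i → i ≤ 2 → 2 ^ (E i * t) ≤ T3Poly t i
T3Poly-lower-bound t zero _ = ≤-trans (≤-reflexive (sym (childPoly-^ₚ-coeff-0 t 3))) (m≤m+n _ _)
T3Poly-lower-bound t (suc zero) _ = begin
  2 ^ (1 * t)                               ≡⟨ cong (2 ^_) (*-identityˡ t) ⟩
  2 ^ t                                     ≡⟨ ^ₚ-coeff-0 (X+ 2) t ⟨
  (X+ 2 ^ₚ t) 0                            ≤⟨ m≤m+n _ _ ⟩
  childPoly t 1                             ≡⟨ *-identityʳ _ ⟨
  childPoly t 1 * 1                         ≡⟨ cong (childPoly t 1 *_) (childPoly-^ₚ-coeff-0 t 2) ⟨
  childPoly t 1 * (childPoly t ^ₚ 2) 0      ≤⟨ ⊛-coeff-≥ (childPoly t) (childPoly t ^ₚ 2) 1 0 ⟩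
  (childPoly t ^ₚ 3) 1                      ≤⟨ m≤m+n _ _ ⟩
  T3Poly t 1                                ∎
  where open ≤-Reasoning
T3Poly-lower-bound t (suc (suc zero)) _ = begin
  2 ^ (3 * t)             ≡⟨ trans (cong (2 ^_) (*-comm 3 t)) (sym (^-*-assoc 2 t 3)) ⟩
  (2 ^ t) ^ 3             ≡⟨ cong (_^ 3) (^ₚ-coeff-0 (X+ 2) t) ⟨
  (X+ 2 ^ₚ t) 0 ^ 3      ≡⟨ ^ₚ-coeff-0 (X+ 2 ^ₚ t) 3 ⟨
  (X+ 2 ^ₚ t ^ₚ 3) 0     ≤⟨ m≤n+m _ _ ⟩
  T3Poly t 2              ∎
  where open ≤-Reasoning
T3Poly-lower-bound t (suc (suc (suc i))) (s≤s (s≤s ()))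

TGPoly-lower-bound : ∀ m t k → k ≤ 2 * m → 2 ^ (E k * t) ≤ TGPoly m t k
TGPoly-lower-bound m t k k≤2m = begin
  2 ^ (E k * t)                      ≤⟨ ^ₚ-lower-bound t (T3Poly t) (T3Poly-lower-bound t) m k k≤2m ⟩
  (T3Poly t ^ₚ m) k                  ≡⟨ *-identityˡ _ ⟨
  (X+ 1) 0 * (T3Poly t ^ₚ m) k       ≤⟨ ⊛-coeff-≥ (X+ 1) (T3Poly t ^ₚ m) 0 k ⟩
  (X+ 1 ⊛ T3Poly t ^ₚ m) k          ≤⟨ m≤m+n _ _ ⟩
  TGPoly m t k                       ∎
  where open ≤-Reasoning

-- Sums over subsets

⟦_⟧ : Bool → ℕ
⟦ true  ⟧ = 1
⟦ false ⟧ = 0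

count : {A : Set} → (A → Bool) → List A → ℕ
count p []       = 0
count p (x ∷ xs) = ⟦ p x ⟧ + count p xs

length-filterᵇ : ∀ {A : Set} (p : A → Bool) xs → length (filterᵇ p xs) ≡ count p xs
length-filterᵇ p []       = refl
length-filterᵇ p (x ∷ xs) with p x
... | true  = cong suc (length-filterᵇ p xs)
... | false = length-filterᵇ p xs

count-++ : ∀ {A : Set} (p : A → Bool) xs ys → count p (xs ++ₗ ys) ≡ count p xs + count p ys
count-++ p []       ys = refl
count-++ p (x ∷ xs) ys = trans (cong (⟦ p x ⟧ +_) (count-++ p xs ys)) (sym (+-assoc ⟦ p x ⟧ _ _))

count-map : ∀ {A B : Set} (p : B → Bool) (f : A → B) xs → count p (map f xs) ≡ count (λ x → p (f x)) xs
count-map p f []       = refl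
count-map p f (x ∷ xs) = cong (⟦ p (f x) ⟧ +_) (count-map p f xs)

sumSubsets : (n : ℕ) → (Subset n → ℕ) → ℕ
sumSubsets zero    f = f []
sumSubsets (suc n) f = sumSubsets n (λ s → f (outside ∷ s)) + sumSubsets n (λ s → f (inside ∷ s))

count-allSubsets : ∀ n (p : Subset n → Bool) → count p (allSubsets n) ≡ sumSubsets n (λ s → ⟦ p s ⟧)
count-allSubsets zero    p = +-identityʳ _
count-allSubsets (suc n) p = begin
  count p (map (outside ∷_) (allSubsets n) ++ₗ map (inside ∷_) (allSubsets n))
    ≡⟨ count-++ p (map (outside ∷_) (allSubsets n)) (map (inside ∷_) (allSubsets n)) ⟩
  count p (map (outside ∷_) (allSubsets n)) + count p (map (inside ∷_) (allSubsets n))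
    ≡⟨ cong₂ _+_ (trans (count-map p (outside ∷_) (allSubsets n)) (count-allSubsets n _))
                 (trans (count-map p (inside ∷_) (allSubsets n)) (count-allSubsets n _)) ⟩
  sumSubsets (suc n) (λ s → ⟦ p s ⟧) ∎
  where open ≡-Reasoning

sumSubsets-cong : ∀ n {f g : Subset n → ℕ} → (∀ s → f s ≡ g s) → sumSubsets n f ≡ sumSubsets n g
sumSubsets-cong zero    f≡g = f≡g []
sumSubsets-cong (suc n) f≡g =
  cong₂ _+_ (sumSubsets-cong n (λ s → f≡g (outside ∷ s))) (sumSubsets-cong n (λ s → f≡g (inside ∷ s)))

sumSubsets-zero : ∀ n → sumSubsets n (λ _ → 0) ≡ 0
sumSubsets-zero zero    = refl
sumSubsets-zero (suc n) = cong₂ _+_ (sumSubsets-zero n) (sumSubsets-zero n)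

sumSubsets-++ : ∀ a b (f : Subset (a + b) → ℕ) →
                sumSubsets (a + b) f ≡ sumSubsets a (λ x → sumSubsets b (λ y → f (x ++ y)))
sumSubsets-++ zero    b f = refl
sumSubsets-++ (suc a) b f = cong₂ _+_ (sumSubsets-++ a b _) (sumSubsets-++ a b _)

sumSubsetsₚ : (n : ℕ) → (Subset n → Poly) → Poly
sumSubsetsₚ n F k = sumSubsets n (λ s → F s k)

sumSubsetsₚ-cong : ∀ n {F G : Subset n → Poly} → (∀ s → F s ≗ G s) → sumSubsetsₚ n F ≗ sumSubsetsₚ n G
sumSubsetsₚ-cong n F≗G k = sumSubsets-cong n (λ s → F≗G s k)

sumSubsetsₚ-shift : ∀ n (F : Subset n → Poly) → sumSubsetsₚ n (λ s → shift (F s)) ≗ shift (sumSubsetsₚ n F)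
sumSubsetsₚ-shift n F zero    = sumSubsets-zero n
sumSubsetsₚ-shift n F (suc k) = refl

⊛-sumSubsetsₚ : ∀ n p (F : Subset n → Poly) → sumSubsetsₚ n (λ s → p ⊛ F s) ≗ p ⊛ sumSubsetsₚ n F
⊛-sumSubsetsₚ zero    p F k = refl
⊛-sumSubsetsₚ (suc n) p F k =
  trans (cong₂ _+_ (⊛-sumSubsetsₚ n p F₀ k) (⊛-sumSubsetsₚ n p F₁ k))
        (sym (⊛-distribˡ-⊕ p (sumSubsetsₚ n F₀) (sumSubsetsₚ n F₁) k))
  where
  F₀ F₁ : Subset n → Poly
  F₀ s = F (outside ∷ s)
  F₁ s = F (inside ∷ s)

sumSubsetsₚ-⊛ : ∀ n q (F : Subset n → Poly) → sumSubsetsₚ n (λ s → F s ⊛ q) ≗ sumSubsetsₚ n F ⊛ q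
sumSubsetsₚ-⊛ zero    q F k = refl
sumSubsetsₚ-⊛ (suc n) q F k =
  trans (cong₂ _+_ (sumSubsetsₚ-⊛ n q F₀ k) (sumSubsetsₚ-⊛ n q F₁ k))
        (sym (⊛-distribʳ-⊕ q (sumSubsetsₚ n F₀) (sumSubsetsₚ n F₁) k))
  where
  F₀ F₁ : Subset n → Poly
  F₀ s = F (outside ∷ s)
  F₁ s = F (inside ∷ s)

take-++ : ∀ {A : Set} {a b} (x : Vec A a) (y : Vec A b) → take a (x ++ y) ≡ x
take-++ []      y = refl
take-++ (z ∷ x) y = cong (z ∷_) (take-++ x y)

drop-++ : ∀ {A : Set} {a b} (x : Vec A a) (y : Vec A b) → drop a (x ++ y) ≡ y
drop-++ []      y = refl
drop-++ (z ∷ x) y = drop-++ x y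

sumSubsetsₚ-split : ∀ a b (F : Subset a → Poly) (G : Subset b → Poly) →
  sumSubsetsₚ (a + b) (λ s → F (take a s) ⊛ G (drop a s)) ≗ sumSubsetsₚ a F ⊛ sumSubsetsₚ b G
sumSubsetsₚ-split a b F G k = begin
  sumSubsetsₚ (a + b) (λ s → F (take a s) ⊛ G (drop a s)) k
    ≡⟨ sumSubsets-++ a b _ ⟩
  sumSubsets a (λ x → sumSubsets b (λ y → (F (take a (x ++ y)) ⊛ G (drop a (x ++ y))) k))
    ≡⟨ sumSubsets-cong a (λ x → sumSubsets-cong b (λ y →
         cong₂ (λ x′ y′ → (F x′ ⊛ G y′) k) (take-++ x y) (drop-++ x y))) ⟩
  sumSubsets a (λ x → sumSubsetsₚ b (λ y → F x ⊛ G y) k)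
    ≡⟨ sumSubsets-cong a (λ x → ⊛-sumSubsetsₚ b (F x) G k) ⟩
  sumSubsetsₚ a (λ x → F x ⊛ sumSubsetsₚ b G) k
    ≡⟨ sumSubsetsₚ-⊛ a (sumSubsetsₚ b G) F k ⟩
  (sumSubsetsₚ a F ⊛ sumSubsetsₚ b G) k ∎
  where open ≡-Reasoning

-- Independent sets of graphs given by edge lists

T-injective : ∀ {x y} → (T x → T y) → (T y → T x) → x ≡ y
T-injective {false} {false} _ _ = refl
T-injective {false} {true}  _ g = ⊥-elim (g _)
T-injective {true}  {false} f _ = ⊥-elim (f _)
T-injective {true}  {true}  _ _ = refl

T-not : ∀ {x} → ¬ T x → T (not x)
T-not {false} _  = _
T-not {true}  ¬x = ¬x _

T-not⁻ : ∀ {x} → T (not x) → ¬ T x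
T-not⁻ {false} _ ()

T-all-allFin : ∀ {n} (p : Fin n → Bool) → (∀ i → T (p i)) → T (all p (allFin n))
T-all-allFin p h = all⁻ p (tabulate⁺ h)

T-all-allFin⁻ : ∀ {n} (p : Fin n → Bool) → T (all p (allFin n)) → ∀ i → T (p i)
T-all-allFin⁻ p h i = All.lookup (all⁺ p _ h) (∈-allFin i)

member≡lookup : ∀ {n} (s : Subset n) i → member s i ≡ lookup s i
member≡lookup s i with lookup s i
... | true  = refl
... | false = refl

Independent : (G : Graph) → Subset (size G) → Set
Independent G s = ∀ i j → T (lookup s i) → T (lookup s j) → ¬ T (adj G i j)

isIndependent-sound : ∀ G s → T (isIndependent G s) → Independent G s
isIndependent-sound G s h i j si sj ij = T-not⁻ cell
  (Equivalence.from T-∧ (subst T (sym (member≡lookup s i)) si ,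
     Equivalence.from T-∧ (subst T (sym (member≡lookup s j)) sj , ij)))
  where
  cell : T (not (member s i ∧ member s j ∧ adj G i j))
  cell = T-all-allFin⁻ _ (T-all-allFin⁻ _ h i) j

isIndependent-complete : ∀ G s → Independent G s → T (isIndependent G s)
isIndependent-complete G s ind = T-all-allFin _ λ i → T-all-allFin _ λ j → T-not λ h →
  let si , h′ = Equivalence.to T-∧ h
      sj , ij = Equivalence.to T-∧ h′
  in ind i j (subst T (member≡lookup s i) si) (subst T (member≡lookup s j) sj) ij

at : List Bool → ℕ → Bool
at []       _       = false
at (x ∷ xs) zero    = x
at (x ∷ xs) (suc a) = at xs a

at-toList : ∀ {n} (s : Subset n) i → at (toList s) (toℕ i) ≡ lookup s i
at-toList (x ∷ s) Fin.zero    = refl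
at-toList (x ∷ s) (Fin.suc i) = at-toList s i

at-<length : ∀ L a → T (at L a) → a < length L
at-<length (x ∷ L) zero    _  = s≤s z≤n
at-<length (x ∷ L) (suc a) La = s≤s (at-<length L a La)

avoids : List (ℕ × ℕ) → List Bool → Bool
avoids []             L = true
avoids ((u , v) ∷ es) L = not (at L u ∧ at L v) ∧ avoids es L

Avoids : List (ℕ × ℕ) → List Bool → Set
Avoids es L = ∀ a b → T (at L a) → T (at L b) → ¬ T (isEdge es a b)

isEdge-∷ : ∀ u v es a b → T (isEdge ((u , v) ∷ es) a b) →
           (u ≡ a × v ≡ b) ⊎ (u ≡ b × v ≡ a) ⊎ T (isEdge es a b)
isEdge-∷ u v es a b e with Equivalence.to T-∨ e
... | inj₂ e′ = inj₂ (inj₂ e′)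
... | inj₁ e₁ with Equivalence.to T-∨ e₁
...   | inj₁ h = let ua , vb = Equivalence.to T-∧ h in inj₁ (≡ᵇ⇒≡ u a ua , ≡ᵇ⇒≡ v b vb)
...   | inj₂ h = let ub , va = Equivalence.to T-∧ h in inj₂ (inj₁ (≡ᵇ⇒≡ u b ub , ≡ᵇ⇒≡ v a va))

avoids-sound : ∀ es L → T (avoids es L) → Avoids es L
avoids-sound ((u , v) ∷ es) L h a b La Lb e with Equivalence.to T-∧ h | isEdge-∷ u v es a b e
... | uv , _  | inj₁ (refl , refl)        = T-not⁻ uv (Equivalence.from T-∧ (La , Lb))
... | uv , _  | inj₂ (inj₁ (refl , refl)) = T-not⁻ uv (Equivalence.from T-∧ (Lb , La))
... | _  , h′ | inj₂ (inj₂ e′)            = avoids-sound es L h′ a b La Lb e′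

avoids-complete : ∀ es L → Avoids es L → T (avoids es L)
avoids-complete []             L _   = _
avoids-complete ((u , v) ∷ es) L avd = Equivalence.from T-∧
  ( T-not (λ h → let Lu , Lv = Equivalence.to T-∧ h in avd u v Lu Lv uv-edge)
  , avoids-complete es L (λ a b La Lb e → avd a b La Lb (Equivalence.from T-∨ (inj₂ e))))
  where
  uv-edge : T (isEdge ((u , v) ∷ es) u v)
  uv-edge = Equivalence.from T-∨ (inj₁ (Equivalence.from T-∨ (inj₁
              (Equivalence.from T-∧ (≡⇒≡ᵇ u u refl , ≡⇒≡ᵇ v v refl)))))

edgeListGraph : ℕ → List (ℕ × ℕ) → Graph
edgeListGraph n es = record { size = n ; adj = λ i j → isEdge es (toℕ i) (toℕ j) }

vertex-of : ∀ {n} (s : Subset n) a → T (at (toList s) a) → Σ[ i ∈ Fin n ] (toℕ i ≡ a × T (lookup s i))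
vertex-of {n} s a sa =
  i , toℕ-fromℕ< a<n , subst T (trans (cong (at (toList s)) (sym (toℕ-fromℕ< a<n))) (at-toList s i)) sa
  where
  a<n : a < n
  a<n = subst (a <_) (length-toList s) (at-<length (toList s) a sa)
  i : Fin n
  i = fromℕ< a<n

avoids-of-independent : ∀ {n} es (s : Subset n) → Independent (edgeListGraph n es) s → Avoids es (toList s)
avoids-of-independent es s ind a b sa sb with vertex-of s a sa | vertex-of s b sb
... | i , refl , si | j , refl , sj = ind i j si sj

independent-of-avoids : ∀ {n} es (s : Subset n) → Avoids es (toList s) → Independent (edgeListGraph n es) s
independent-of-avoids es s avd i j si sj =
  avd (toℕ i) (toℕ j) (subst T (sym (at-toList s i)) si) (subst T (sym (at-toList s j)) sj)

isIndependent-edgeListGraph : ∀ n es (s : Subset n) → isIndependent (edgeListGraph n es) s ≡ avoids es (toList s)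
isIndependent-edgeListGraph n es s = T-injective
  (λ h → avoids-complete es (toList s) (avoids-of-independent es s (isIndependent-sound _ s h)))
  (λ h → isIndependent-complete _ s (independent-of-avoids es s (avoids-sound es (toList s) h)))

-- Independent sets of trees

rootIn : (τ : Tree) → Subset (tsize τ) → Side
rootIn (node _) (b ∷ _) = b

mutual
  isIndependentTree : (τ : Tree) → Subset (tsize τ) → Bool
  isIndependentTree (node ts) (b ∷ s) = isIndependentForest b ts s

  isIndependentForest : Side → (ts : List Tree) → Subset (tsizes ts) → Bool
  isIndependentForest b []       []  = true
  isIndependentForest b (t ∷ ts) s =
    isIndependentUnder b t (take (tsize t) s) ∧ isIndependentForest b ts (drop (tsize t) s)

  isIndependentUnder : Side → (τ : Tree) → Subset (tsize τ) → Bool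
  isIndependentUnder b τ s = not (b ∧ rootIn τ s) ∧ isIndependentTree τ s

avoids-++ : ∀ es fs L → avoids (es ++ₗ fs) L ≡ avoids es L ∧ avoids fs L
avoids-++ []             fs L = refl
avoids-++ ((u , v) ∷ es) fs L =
  trans (cong (not (at L u ∧ at L v) ∧_) (avoids-++ es fs L)) (sym (∧-assoc (not (at L u ∧ at L v)) _ _))

at-length : ∀ pre (x : Bool) post → at (pre ++ₗ x ∷ post) (length pre) ≡ x
at-length []        x post = refl
at-length (y ∷ pre) x post = at-length pre x post

at-root : ∀ τ (s : Subset (tsize τ)) pre post → at (pre ++ₗ toList s ++ₗ post) (length pre) ≡ rootIn τ s
at-root (node ts) (b ∷ s) pre post = at-length pre b (toList s ++ₗ post)

mutual
  -- tedges o τ labels τ in preorder from o on, so s sits in L at the positions o, o + 1, …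
  avoids-tedges : ∀ τ L o pre post (s : Subset (tsize τ)) → length pre ≡ o →
                  L ≡ pre ++ₗ toList s ++ₗ post → avoids (tedges o τ) L ≡ isIndependentTree τ s
  avoids-tedges (node ts) L o pre post (b ∷ s) refl refl =
    avoids-childEdges ts L (length pre) (suc (length pre)) (pre ++ₗ b ∷ []) post s b
      (trans (length-++ pre) (+-comm (length pre) 1))
      (sym (++-assoc pre (b ∷ []) (toList s ++ₗ post)))
      (at-length pre b (toList s ++ₗ post))

  avoids-childEdges : ∀ ts L p o pre post (s : Subset (tsizes ts)) b → length pre ≡ o →
                      L ≡ pre ++ₗ toList s ++ₗ post → at L p ≡ b →
                      avoids (childEdges p o ts) L ≡ isIndependentForest b ts s
  avoids-childEdges []       L p o pre post [] b _    _    _    = refl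
  avoids-childEdges (t ∷ ts) L p o pre post s  b refl refl refl = begin
    not (b ∧ at L o) ∧ avoids (tedges o t ++ₗ childEdges p (o + tsize t) ts) L
      ≡⟨ cong₂ (λ r e → not (b ∧ r) ∧ e)
               (trans (cong (λ L′ → at L′ o) L≡) (at-root t x pre (toList y ++ₗ post)))
               (avoids-++ (tedges o t) (childEdges p (o + tsize t) ts) L) ⟩
    not (b ∧ rootIn t x) ∧ (avoids (tedges o t) L ∧ avoids (childEdges p (o + tsize t) ts) L)
      ≡⟨ cong₂ (λ u w → not (b ∧ rootIn t x) ∧ (u ∧ w))
               (avoids-tedges t L o pre (toList y ++ₗ post) x refl L≡)
               (avoids-childEdges ts L p (o + tsize t) (pre ++ₗ toList x) post y b
                  (trans (length-++ pre) (cong (o +_) (length-toList x)))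
                  (trans L≡ (sym (++-assoc pre (toList x) _))) refl) ⟩
    not (b ∧ rootIn t x) ∧ (isIndependentTree t x ∧ isIndependentForest b ts y)
      ≡⟨ sym (∧-assoc (not (b ∧ rootIn t x)) _ _) ⟩
    isIndependentForest b (t ∷ ts) s ∎
    where
    open ≡-Reasoning
    x : Subset (tsize t)
    x = take (tsize t) s
    y : Subset (tsizes ts)
    y = drop (tsize t) s
    L≡ : L ≡ pre ++ₗ toList x ++ₗ (toList y ++ₗ post)
    L≡ = cong (pre ++ₗ_) (begin
      toList s ++ₗ post                ≡⟨ cong (λ s′ → toList s′ ++ₗ post) (take++drop≡id (tsize t) s) ⟨
      toList (x ++ y) ++ₗ post         ≡⟨ cong (_++ₗ post) (toList-++ x y) ⟩
      (toList x ++ₗ toList y) ++ₗ post ≡⟨ ++-assoc (toList x) (toList y) post ⟩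
      toList x ++ₗ (toList y ++ₗ post) ∎)

isIndependent-treeGraph : ∀ τ s → isIndependent (treeGraph τ) s ≡ isIndependentTree τ s
isIndependent-treeGraph τ s = trans (isIndependent-edgeListGraph (tsize τ) (tedges 0 τ) s)
  (avoids-tedges τ (toList s) 0 [] [] s refl (sym (++-identityʳ (toList s))))

-- Independence polynomials of trees, counted by vertices left out

weight : ∀ {n} → Bool → Subset n → Poly
weight b s = if b then X^ ∣ ∁ s ∣ else 0ₚ

∣∁-++∣ : ∀ {a b} (x : Subset a) (y : Subset b) → ∣ ∁ (x ++ y) ∣ ≡ ∣ ∁ x ∣ + ∣ ∁ y ∣
∣∁-++∣ []            y = refl
∣∁-++∣ (inside ∷ x)  y = ∣∁-++∣ x y
∣∁-++∣ (outside ∷ x) y = cong suc (∣∁-++∣ x y)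

weight-++ : ∀ {a b} c d (x : Subset a) (y : Subset b) → weight (c ∧ d) (x ++ y) ≗ weight c x ⊛ weight d y
weight-++ false d     x y k = sym (⊛-zeroˡ (weight d y) k)
weight-++ true  false x y k = sym (⊛-zeroʳ (X^ ∣ ∁ x ∣) k)
weight-++ true  true  x y k = trans (cong (λ a → X^ a k) (∣∁-++∣ x y)) (X^-+ ∣ ∁ x ∣ ∣ ∁ y ∣ k)

weight-outside∷ : ∀ {n} c (s : Subset n) → weight c (outside ∷ s) ≗ shift (weight c s)
weight-outside∷ true  s k       = refl
weight-outside∷ false s zero    = refl
weight-outside∷ false s (suc k) = refl

-- b is the side of the parent of τ's root: if it is inside, the root must be outside.
treePoly : Side → Tree → Poly
treePoly b τ = sumSubsetsₚ (tsize τ) (λ s → weight (isIndependentUnder b τ s) s)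

forestPoly : Side → List Tree → Poly
forestPoly b []       = 1ₚ
forestPoly b (t ∷ ts) = treePoly b t ⊛ forestPoly b ts

forestPoly-replicate : ∀ b n τ → forestPoly b (replicate n τ) ≡ treePoly b τ ^ₚ n
forestPoly-replicate b zero    τ = refl
forestPoly-replicate b (suc n) τ = cong (treePoly b τ ⊛_) (forestPoly-replicate b n τ)

sumSubsets-forest : ∀ b ts →
  sumSubsetsₚ (tsizes ts) (λ s → weight (isIndependentForest b ts s) s) ≗ forestPoly b ts
sumSubsets-forest b []       k = refl
sumSubsets-forest b (t ∷ ts) k = begin
  sumSubsetsₚ (tsize t + tsizes ts) (λ s → weight (isIndependentForest b (t ∷ ts) s) s) k
    ≡⟨ sumSubsetsₚ-cong (tsize t + tsizes ts) split k ⟩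
  sumSubsetsₚ (tsize t + tsizes ts) (λ s → F (take (tsize t) s) ⊛ G (drop (tsize t) s)) k
    ≡⟨ sumSubsetsₚ-split (tsize t) (tsizes ts) F G k ⟩
  (treePoly b t ⊛ sumSubsetsₚ (tsizes ts) G) k
    ≡⟨ ⊛-cong (λ _ → refl) (sumSubsets-forest b ts) k ⟩
  forestPoly b (t ∷ ts) k ∎
  where
  open ≡-Reasoning
  F : Subset (tsize t) → Poly
  F x = weight (isIndependentUnder b t x) x
  G : Subset (tsizes ts) → Poly
  G y = weight (isIndependentForest b ts y) y
  split : ∀ s → weight (isIndependentForest b (t ∷ ts) s) s ≗ F (take (tsize t) s) ⊛ G (drop (tsize t) s)
  split s k = trans (cong (λ s′ → weight (isIndependentForest b (t ∷ ts) s) s′ k)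
                          (sym (take++drop≡id (tsize t) s)))
                    (weight-++ (isIndependentUnder b t (take (tsize t) s)) (isIndependentForest b ts (drop (tsize t) s))
                               (take (tsize t) s) (drop (tsize t) s) k)

sumSubsets-rootOutside : ∀ ts →
  sumSubsetsₚ (tsizes ts) (λ s → weight (isIndependentForest outside ts s) (outside ∷ s))
    ≗ shift (forestPoly outside ts)
sumSubsets-rootOutside ts k = begin
  sumSubsetsₚ (tsizes ts) (λ s → weight (forest s) (outside ∷ s)) k
    ≡⟨ sumSubsetsₚ-cong (tsizes ts) (λ s → weight-outside∷ (forest s) s) k ⟩
  sumSubsetsₚ (tsizes ts) (λ s → shift (weight (forest s) s)) k
    ≡⟨ sumSubsetsₚ-shift (tsizes ts) (λ s → weight (forest s) s) k ⟩
  shift (sumSubsetsₚ (tsizes ts) (λ s → weight (forest s) s)) k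
    ≡⟨ shift-cong (sumSubsets-forest outside ts) k ⟩
  shift (forestPoly outside ts) k ∎
  where
  open ≡-Reasoning
  forest : Subset (tsizes ts) → Bool
  forest = isIndependentForest outside ts

treePoly-outside-node : ∀ ts → treePoly outside (node ts) ≗ shift (forestPoly outside ts) ⊕ forestPoly inside ts
treePoly-outside-node ts k = cong₂ _+_ (sumSubsets-rootOutside ts k) (sumSubsets-forest inside ts k)

treePoly-inside-node : ∀ ts → treePoly inside (node ts) ≗ shift (forestPoly outside ts)
treePoly-inside-node ts k =
  trans (cong₂ _+_ (sumSubsets-rootOutside ts k) (sumSubsets-zero (tsizes ts))) (+-identityʳ _)

X^-coeff : ∀ a c → X^ a c ≡ ⟦ a ≡ᵇ c ⟧
X^-coeff zero    zero    = refl
X^-coeff zero    (suc c) = refl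
X^-coeff (suc a) zero    = refl
X^-coeff (suc a) (suc c) = X^-coeff a c

∣∁∣≡ᵇ∸ : ∀ {n} (s : Subset n) x → x ≤ n → (∣ s ∣ ≡ᵇ x) ≡ (∣ ∁ s ∣ ≡ᵇ n ∸ x)
∣∁∣≡ᵇ∸ {n} s x x≤n = T-injective
  (λ h → ≡⇒≡ᵇ _ _ (trans (∣∁p∣≡n∸∣p∣ s) (cong (n ∸_) (≡ᵇ⇒≡ ∣ s ∣ x h))))
  (λ h → ≡⇒≡ᵇ _ _ (∸-cancelˡ-≡ (∣p∣≤n s) x≤n (trans (sym (∣∁p∣≡n∸∣p∣ s)) (≡ᵇ⇒≡ ∣ ∁ s ∣ (n ∸ x) h))))

indepCount-sum : ∀ G x →
  indepCount G x ≡ sumSubsets (size G) (λ s → ⟦ (∣ s ∣ ≡ᵇ x) ∧ isIndependent G s ⟧)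
indepCount-sum G x = trans (length-filterᵇ _ (allSubsets (size G))) (count-allSubsets (size G) _)

indepCount-treeGraph : ∀ τ x → x ≤ tsize τ → indepCount (treeGraph τ) x ≡ treePoly outside τ (tsize τ ∸ x)
indepCount-treeGraph τ x x≤n = trans (indepCount-sum (treeGraph τ) x) (sumSubsets-cong (tsize τ) summand)
  where
  summand : ∀ s →
    ⟦ (∣ s ∣ ≡ᵇ x) ∧ isIndependent (treeGraph τ) s ⟧ ≡ weight (isIndependentTree τ s) s (tsize τ ∸ x)
  summand s rewrite isIndependent-treeGraph τ s with isIndependentTree τ s
  ... | true  = trans (cong ⟦_⟧ (trans (∧-identityʳ _) (∣∁∣≡ᵇ∸ s x x≤n)))
                      (sym (X^-coeff ∣ ∁ s ∣ (tsize τ ∸ x)))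
  ... | false = cong ⟦_⟧ (∧-zeroʳ (∣ s ∣ ≡ᵇ x))

indepCount-large : ∀ G x → size G < x → indepCount G x ≡ 0
indepCount-large G x n<x =
  trans (indepCount-sum G x) (trans (sumSubsets-cong (size G) summand) (sumSubsets-zero (size G)))
  where
  summand : ∀ s → ⟦ (∣ s ∣ ≡ᵇ x) ∧ isIndependent G s ⟧ ≡ 0
  summand s rewrite Equivalence.to T-not-≡ (T-not (λ h → <⇒≢ (≤-<-trans (∣p∣≤n s) n<x) (≡ᵇ⇒≡ ∣ s ∣ x h)))
    = refl

maxSupport : (ℕ → ℕ) → List ℕ → ℕ
maxSupport f = foldr (λ k d → if f k ≡ᵇ 0 then d else k ⊔ d) 0

maxSupport-≤ : ∀ f a xs → (∀ x → 0 < f x → x ≤ a) → maxSupport f xs ≤ a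
maxSupport-≤ f a []       _ = z≤n
maxSupport-≤ f a (x ∷ xs) h with f x in fx
... | zero  = maxSupport-≤ f a xs h
... | suc _ = ⊔-lub (h x (subst (0 <_) (sym fx) (s≤s z≤n))) (maxSupport-≤ f a xs h)

≤-maxSupport : ∀ f a xs → a ∈ xs → 0 < f a → a ≤ maxSupport f xs
≤-maxSupport f a (x ∷ xs) (here refl) fa>0 with f x
... | suc _ = m≤m⊔n x _
≤-maxSupport f a (x ∷ xs) (there a∈xs) fa>0 with f x
... | zero  = ≤-maxSupport f a xs a∈xs fa>0
... | suc _ = ≤-trans (≤-maxSupport f a xs a∈xs fa>0) (m≤n⊔m x _)

indepDegree-≡ : ∀ G a → a ≤ size G → 0 < indepCount G a → (∀ x → a < x → indepCount G x ≡ 0) →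
                indepDegree G ≡ a
indepDegree-≡ G a a≤n count-a>0 count>a≡0 = ≤-antisym
  (maxSupport-≤ (indepCount G) a (upTo (suc (size G))) nonzero⇒≤a)
  (≤-maxSupport (indepCount G) a (upTo (suc (size G))) (∈-upTo⁺ (s≤s a≤n)) count-a>0)
  where
  nonzero⇒≤a : ∀ x → 0 < indepCount G x → x ≤ a
  nonzero⇒≤a x count-x>0 with x ≤? a
  ... | yes x≤a = x≤a
  ... | no  x≰a = ⊥-elim (<⇒≢ count-x>0 (sym (count>a≡0 x (≰⇒> x≰a))))

reflIndepCoeff-≡ : ∀ G {a k} → indepDegree G ≡ a → k ≤ a → reflIndepCoeff G k ≡ indepCount G (a ∸ k)
reflIndepCoeff-≡ G refl k≤a rewrite Equivalence.to T-≡ (≤⇒≤ᵇ k≤a) = refl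

shift^-coeff-+ : ∀ a p k → shift^ a p (a + k) ≡ p k
shift^-coeff-+ zero    p k = refl
shift^-coeff-+ (suc a) p k = shift^-coeff-+ a p k

shift^-coeff-< : ∀ a p {j} → j < a → shift^ a p j ≡ 0
shift^-coeff-< (suc a) p {zero}  _         = refl
shift^-coeff-< (suc a) p {suc j} (s≤s j<a) = shift^-coeff-< a p j<a

shift-shift^ : ∀ a p → shift (shift^ a p) ≡ shift^ a (shift p)
shift-shift^ a p = trans (cong (λ n → shift^ n p) (+-comm 1 a)) (sym (shift^-+ a 1 p))

forestPoly-replicate-shift^ : ∀ b n τ a p → treePoly b τ ≗ shift^ a p →
                              forestPoly b (replicate n τ) ≗ shift^ (n * a) (p ^ₚ n)
forestPoly-replicate-shift^ b n τ a p τ≗ k =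
  trans (cong (λ q → q k) (forestPoly-replicate b n τ)) (trans (^ₚ-cong n τ≗ k) (shift^-^ₚ a p n k))

treePoly-leaf : treePoly outside leaf ≗ X+ 1
treePoly-leaf zero          = refl
treePoly-leaf (suc zero)    = refl
treePoly-leaf (suc (suc k)) = refl

treePoly-inside-leaf : treePoly inside leaf ≗ shift 1ₚ
treePoly-inside-leaf = treePoly-inside-node []

treePoly-pendantP2 : treePoly outside pendantP2 ≗ shift (X+ 2)
treePoly-pendantP2 = begin
  treePoly outside pendantP2
    ≈⟨ treePoly-outside-node (leaf ∷ []) ⟩
  shift (treePoly outside leaf ⊛ 1ₚ) ⊕ treePoly inside leaf ⊛ 1ₚ
    ≈⟨ ⊕-cong (shift-cong (⊛-identityʳ _)) (⊛-identityʳ _) ⟩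
  shift (treePoly outside leaf) ⊕ treePoly inside leaf
    ≈⟨ ⊕-cong (shift-cong treePoly-leaf) treePoly-inside-leaf ⟩
  shift (X+ 1) ⊕ shift 1ₚ
    ≈⟨ shift-⊕ (X+ 1) 1ₚ ⟩
  shift (X+ 1 ⊕ 1ₚ)
    ≈⟨ shift-cong X+-suc ⟩
  shift (X+ 2) ∎
  where
  open ≗-Reasoning
  X+-suc : X+ 1 ⊕ 1ₚ ≗ X+ 2
  X+-suc zero          = refl
  X+-suc (suc zero)    = refl
  X+-suc (suc (suc k)) = refl

treePoly-inside-pendantP2 : treePoly inside pendantP2 ≗ shift (X+ 1)
treePoly-inside-pendantP2 = begin
  treePoly inside pendantP2           ≈⟨ treePoly-inside-node (leaf ∷ []) ⟩
  shift (treePoly outside leaf ⊛ 1ₚ)  ≈⟨ shift-cong (⊛-identityʳ _) ⟩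
  shift (treePoly outside leaf)       ≈⟨ shift-cong treePoly-leaf ⟩
  shift (X+ 1)                       ∎
  where open ≗-Reasoning

treePoly-childT : ∀ t → treePoly outside (childT t) ≗ shift^ t (childPoly t)
treePoly-childT t = begin
  treePoly outside (childT t)
    ≈⟨ treePoly-outside-node (replicate t pendantP2) ⟩
  shift (forestPoly outside (replicate t pendantP2)) ⊕ forestPoly inside (replicate t pendantP2)
    ≈⟨ ⊕-cong (shift-cong (forestPoly-replicate-shift^ outside t pendantP2 1 (X+ 2) treePoly-pendantP2))
              (forestPoly-replicate-shift^ inside t pendantP2 1 (X+ 1) treePoly-inside-pendantP2) ⟩
  shift (shift^ (t * 1) (X+ 2 ^ₚ t)) ⊕ shift^ (t * 1) (X+ 1 ^ₚ t)
    ≡⟨ cong (λ a → shift (shift^ a (X+ 2 ^ₚ t)) ⊕ shift^ a (X+ 1 ^ₚ t)) (*-identityʳ t) ⟩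
  shift (shift^ t (X+ 2 ^ₚ t)) ⊕ shift^ t (X+ 1 ^ₚ t)
    ≡⟨ cong (_⊕ shift^ t (X+ 1 ^ₚ t)) (shift-shift^ t (X+ 2 ^ₚ t)) ⟩
  shift^ t (shift (X+ 2 ^ₚ t)) ⊕ shift^ t (X+ 1 ^ₚ t)
    ≈⟨ shift^-⊕ t (shift (X+ 2 ^ₚ t)) (X+ 1 ^ₚ t) ⟩
  shift^ t (childPoly t) ∎
  where open ≗-Reasoning

treePoly-inside-childT : ∀ t → treePoly inside (childT t) ≗ shift^ (suc t) (X+ 2 ^ₚ t)
treePoly-inside-childT t = begin
  treePoly inside (childT t)
    ≈⟨ treePoly-inside-node (replicate t pendantP2) ⟩
  shift (forestPoly outside (replicate t pendantP2))
    ≈⟨ shift-cong (forestPoly-replicate-shift^ outside t pendantP2 1 (X+ 2) treePoly-pendantP2) ⟩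
  shift (shift^ (t * 1) (X+ 2 ^ₚ t))
    ≡⟨ cong (λ a → shift^ (suc a) (X+ 2 ^ₚ t)) (*-identityʳ t) ⟩
  shift^ (suc t) (X+ 2 ^ₚ t) ∎
  where open ≗-Reasoning

treePoly-T3 : ∀ t → treePoly outside (T3 t) ≗ shift^ (suc (3 * t)) (T3Poly t)
treePoly-T3 t = begin
  treePoly outside (T3 t)
    ≈⟨ treePoly-outside-node (replicate 3 (childT t)) ⟩
  shift (forestPoly outside (replicate 3 (childT t))) ⊕ forestPoly inside (replicate 3 (childT t))
    ≈⟨ ⊕-cong (shift-cong (forestPoly-replicate-shift^ outside 3 (childT t) t (childPoly t) (treePoly-childT t)))
              (forestPoly-replicate-shift^ inside 3 (childT t) (suc t) (X+ 2 ^ₚ t) (treePoly-inside-childT t)) ⟩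
  shift^ (suc (3 * t)) (childPoly t ^ₚ 3) ⊕ shift^ (3 * suc t) (X+ 2 ^ₚ t ^ₚ 3)
    ≡⟨ cong (shift^ (suc (3 * t)) (childPoly t ^ₚ 3) ⊕_)
            (trans (cong (λ a → shift^ a (X+ 2 ^ₚ t ^ₚ 3)) 3[1+t]≡[1+3t]+2)
                   (sym (shift^-+ (suc (3 * t)) 2 (X+ 2 ^ₚ t ^ₚ 3)))) ⟩
  shift^ (suc (3 * t)) (childPoly t ^ₚ 3) ⊕ shift^ (suc (3 * t)) (shift (shift (X+ 2 ^ₚ t ^ₚ 3)))
    ≈⟨ shift^-⊕ (suc (3 * t)) (childPoly t ^ₚ 3) (shift (shift (X+ 2 ^ₚ t ^ₚ 3))) ⟩
  shift^ (suc (3 * t)) (T3Poly t) ∎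
  where
  open ≗-Reasoning
  3[1+t]≡[1+3t]+2 : 3 * suc t ≡ suc (3 * t) + 2
  3[1+t]≡[1+3t]+2 = trans (*-suc 3 t) (trans (+-comm 3 (3 * t)) (+-suc (3 * t) 2))

treePoly-inside-T3 : ∀ t → treePoly inside (T3 t) ≗ shift^ (suc (3 * t)) (childPoly t ^ₚ 3)
treePoly-inside-T3 t = begin
  treePoly inside (T3 t)
    ≈⟨ treePoly-inside-node (replicate 3 (childT t)) ⟩
  shift (forestPoly outside (replicate 3 (childT t)))
    ≈⟨ shift-cong (forestPoly-replicate-shift^ outside 3 (childT t) t (childPoly t) (treePoly-childT t)) ⟩
  shift^ (suc (3 * t)) (childPoly t ^ₚ 3) ∎
  where open ≗-Reasoning

treePoly-TG : ∀ m t → treePoly outside (TGtree m t) ≗ shift^ (suc (m * suc (3 * t))) (TGPoly m t)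
treePoly-TG m t = begin
  treePoly outside (TGtree m t)
    ≈⟨ treePoly-outside-node (leaf ∷ replicate m (T3 t)) ⟩
  shift (treePoly outside leaf ⊛ forestPoly outside (replicate m (T3 t)))
    ⊕ treePoly inside leaf ⊛ forestPoly inside (replicate m (T3 t))
    ≈⟨ ⊕-cong (shift-cong (⊛-cong treePoly-leaf (forestPoly-replicate-shift^ outside m (T3 t) _ _ (treePoly-T3 t))))
              (⊛-cong treePoly-inside-leaf (forestPoly-replicate-shift^ inside m (T3 t) _ _ (treePoly-inside-T3 t))) ⟩
  shift (X+ 1 ⊛ shift^ M (T3Poly t ^ₚ m)) ⊕ shift 1ₚ ⊛ shift^ M (childPoly t ^ₚ 3 ^ₚ m)
    ≈⟨ ⊕-cong (shift-cong (⊛-shift^ M (X+ 1) (T3Poly t ^ₚ m)))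
              (λ k → trans (shift-⊛ 1ₚ (shift^ M (childPoly t ^ₚ 3 ^ₚ m)) k)
                           (shift-cong (⊛-identityˡ (shift^ M (childPoly t ^ₚ 3 ^ₚ m))) k)) ⟩
  shift^ (suc M) (X+ 1 ⊛ T3Poly t ^ₚ m) ⊕ shift^ (suc M) (childPoly t ^ₚ 3 ^ₚ m)
    ≈⟨ shift^-⊕ (suc M) (X+ 1 ⊛ T3Poly t ^ₚ m) (childPoly t ^ₚ 3 ^ₚ m) ⟩
  shift^ (suc M) (TGPoly m t) ∎
  where
  open ≗-Reasoning
  M : ℕ
  M = m * suc (3 * t)

-- The trees TG_{m,t}

tsizes-replicate : ∀ n τ → tsizes (replicate n τ) ≡ n * tsize τ
tsizes-replicate zero    τ = refl
tsizes-replicate (suc n) τ = cong (tsize τ +_) (tsizes-replicate n τ)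

module _ (m t : ℕ) where
  private
    σ α n : ℕ
    σ = suc (m * suc (3 * t))
    α = suc (m * (3 * suc t))
    n = tsize (TGtree m t)

    n≡σ+α : n ≡ σ + α
    n≡σ+α = begin
      2 + tsizes (replicate m (T3 t))
        ≡⟨ cong (2 +_) (tsizes-replicate m (T3 t)) ⟩
      2 + m * suc (tsizes (replicate 3 (childT t)))
        ≡⟨ cong (λ z → 2 + m * suc z) (tsizes-replicate 3 (childT t)) ⟩
      2 + m * suc (3 * suc (tsizes (replicate t pendantP2)))
        ≡⟨ cong (λ z → 2 + m * suc (3 * suc z)) (tsizes-replicate t pendantP2) ⟩
      2 + m * suc (3 * suc (t * 2))
        ≡⟨ split m t ⟩
      σ + α ∎
      where
      open ≡-Reasoning
      split : ∀ m t → 2 + m * suc (3 * suc (t * 2)) ≡ suc (m * suc (3 * t)) + suc (m * (3 * suc t))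
      split = solve 2 (λ m t → con 2 :+ m :* (con 1 :+ con 3 :* (con 1 :+ t :* con 2))
                            := (con 1 :+ m :* (con 1 :+ con 3 :* t)) :+ (con 1 :+ m :* (con 3 :* (con 1 :+ t)))) refl

    α≤n : α ≤ n
    α≤n = ≤-trans (m≤n+m α σ) (≤-reflexive (sym n≡σ+α))

  indepCount-TG : ∀ k → k ≤ α → indepCount (TG m t) (α ∸ k) ≡ TGPoly m t k
  indepCount-TG k k≤α = begin
    indepCount (TG m t) (α ∸ k)                 ≡⟨ indepCount-treeGraph (TGtree m t) (α ∸ k) α∸k≤n ⟩
    treePoly outside (TGtree m t) (n ∸ (α ∸ k)) ≡⟨ treePoly-TG m t (n ∸ (α ∸ k)) ⟩
    shift^ σ (TGPoly m t) (n ∸ (α ∸ k))         ≡⟨ cong (shift^ σ (TGPoly m t)) n∸[α∸k]≡σ+k ⟩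
    shift^ σ (TGPoly m t) (σ + k)               ≡⟨ shift^-coeff-+ σ (TGPoly m t) k ⟩
    TGPoly m t k                                ∎
    where
    open ≡-Reasoning
    α∸k≤n : α ∸ k ≤ n
    α∸k≤n = ≤-trans (m∸n≤m α k) α≤n
    n∸[α∸k]≡σ+k : n ∸ (α ∸ k) ≡ σ + k
    n∸[α∸k]≡σ+k = trans (cong (_∸ (α ∸ k)) n≡σ+α)
                        (trans (+-∸-assoc σ (m∸n≤m α k)) (cong (σ +_) (m∸[m∸n]≡n k≤α)))

  indepCount-TG-large : ∀ x → α < x → indepCount (TG m t) x ≡ 0
  indepCount-TG-large x α<x with x ≤? n
  ... | no  x≰n = indepCount-large (TG m t) x (≰⇒> x≰n)
  ... | yes x≤n = trans (indepCount-treeGraph (TGtree m t) x x≤n)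
                        (trans (treePoly-TG m t (n ∸ x)) (shift^-coeff-< σ (TGPoly m t) n∸x<σ))
    where
    n∸x<σ : n ∸ x < σ
    n∸x<σ = <-≤-trans (∸-monoʳ-< α<x x≤n) (≤-reflexive (trans (cong (_∸ α) n≡σ+α) (m+n∸n≡m σ α)))

  indepDegree-TG : indepDegree (TG m t) ≡ α
  indepDegree-TG = indepDegree-≡ (TG m t) α α≤n
    (≤-trans (TGPoly-lower-bound m t 0 z≤n) (≤-reflexive (sym (indepCount-TG 0 z≤n))))
    indepCount-TG-large

  reflIndepCoeff-TG : ∀ k → k ≤ 2 * m → reflIndepCoeff (TG m t) k ≡ TGPoly m t k
  reflIndepCoeff-TG k k≤2m = trans (reflIndepCoeff-≡ (TG m t) indepDegree-TG k≤α) (indepCount-TG k k≤α)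
    where
    k≤α : k ≤ α
    k≤α = ≤-trans k≤2m (≤-trans (≤-reflexive (*-comm 2 m))
            (≤-trans (*-monoʳ-≤ m (≤-trans (n≤1+n 2) (*-monoʳ-≤ 3 (s≤s (z≤n {t}))))) (n≤1+n _)))

lemma2p8 : (m : ℕ) → 1 ≤ m → (k : ℕ) → k ≤ 2 * m →
    Theta (λ t → reflIndepCoeff (TG m t) k) (λ t → 2 ^ ((k + k / 2) * t))
-- The bound also holds for m = 0.
lemma2p8 m _ k k≤2m = 1 , constant k , 0 , λ t _ →
    ( ≤-trans (TGPoly-lower-bound m t k k≤2m) (≤-reflexive (trans (sym (coeff t)) (sym (*-identityˡ _))))
    , ≤-trans (≤-reflexive (coeff t)) (bound t k) )
  where
  open Dominated (TGPoly-dominated m)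
  coeff : ∀ t → reflIndepCoeff (TG m t) k ≡ TGPoly m t k
  coeff t = reflIndepCoeff-TG m t k k≤2m
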